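{- Let $p$ be a prime and $\mathcal{S}_p = \{1,\ldots,p-2\}$. Define permutations $F, G : \mathcal{S}_p \to \mathcal{S}_p$ by $F(s) \equiv -1-s \pmod p$ and $G(s) \equiv 1/s \pmod p$ (with values taken in $\mathcal{S}_p$). Then for every $s \in \mathcal{S}_p$ we have $\vartheta_{p,F(s)} = \vartheta_{p,s}$ and $\vartheta_{p,G(s)} = \vartheta_{p,s}$.
   Context: For a prime $p$ and an integer $u$ with $\gcd(u,p)=1$, the Fermat quotient $q_p(u)$ is the unique integer with $0 \le q_p(u) < p$ and $q_p(u) \equiv (u^{p-1}-1)/p \pmod p$. For a rational number $a/b$ with $a,b$ integers coprime to $p$, $q_p(a/b)$ denotes the residue of $q_p(a) - q_p(b)$ modulo $p$ (equivalently, of $((a/b)^{p-1}-1)/p$ computed in the $p$-adic integers); in particular $q_p\big(s^s/(s+1)^{s+1}\big) \equiv s\,q_p(s) - (s+1)\,q_p(s+1) \pmod p$. For $s \in \{1,\ldots,p-2\}$ define the Legendre symbol $$\vartheta_{p,s} = \left(\frac{2s(s+1)\, q_p\big(s^s/(s+1)^{s+1}\big)}{p}\right) \in \{0, 1, -1\}.$$ -}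

module Defs where

open import Data.Nat using (ℕ; zero; suc; _+_; _*_; _∸_; _^_; _%_; _/_; _≡ᵇ_; NonZero)
open import Data.Integer as ℤ using (ℤ; +_; -_)
open import Data.Integer.DivMod using (_%ℕ_)
open import Data.List using (upTo)
open import Data.Bool.ListAction using (any)
open import Data.Bool using (if_then_else_)

-- Fermat quotient of a natural number u (coprime to p, so u^(p-1) ≥ 1):
-- the residue in [0, p) of (u^(p-1) - 1)/p.
fermatQuotient : (p : ℕ) .{{_ : NonZero p}} → ℕ → ℕ
fermatQuotient p u = ((u ^ (p ∸ 1) ∸ 1) / p) % p

legendre : (p : ℕ) .{{_ : NonZero p}} → ℤ → ℤ
legendre p a =
  if (r ≡ᵇ 0) then + 0
  else (if any (λ y → (y * y) % p ≡ᵇ r) (upTo p) then + 1 else - (+ 1))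
  where r = a %ℕ p

-- q_p(s^s / (s+1)^(s+1)) = q_p(s^s) - q_p((s+1)^(s+1))  (as an integer,
-- only its residue mod p matters)
qRatio : (p : ℕ) .{{_ : NonZero p}} → ℕ → ℤ
qRatio p s = + fermatQuotient p (s ^ s) ℤ.- + fermatQuotient p (suc s ^ suc s)

theta : (p : ℕ) .{{_ : NonZero p}} → ℕ → ℤ
theta p s = legendre p (+ (2 * s * suc s) ℤ.* qRatio p s)

module Submission where

-- Write X(s) = 2s(s+1)·q_p(s^s/(s+1)^(s+1)) and D(s) = s^p - (s+1)^p + 1.
-- Since p·q_p(u^u) ≡ u·(u^(p-1) - 1) (mod p²), one gets the key congruence
--     p·X(s) ≡ 2s(s+1)·D(s)   (mod p²),
-- and D(s) ≡ 0 (mod p) by Fermat.  Because x ≡ y (mod p) implies x^p ≡ y^p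
-- (mod p²), D is well behaved under both maps: D(p-1-s) ≡ D(s) (p odd) and
-- D(t) ≡ t^p·D(s) when st ≡ 1.  Dividing by p yields X(p-1-s) ≡ X(s) and
-- X(t) ≡ t⁴·X(s) (mod p), and the Legendre symbol ignores square factors.

open import Defs

module Development where
  open import Data.Nat as ℕ using (ℕ; zero; suc; _∸_; _<_; _≤_; z<s; s<s; s≤s; z≤n; _!; NonZero)
  import Data.Nat.Properties as ℕP
  import Data.Nat.Divisibility as ℕD
  open import Data.Nat.Primality using (Prime; euclidsLemma; prime⇒irreducible; ¬prime[0]; ¬prime[1])
  open import Data.Nat.Combinatorics using (_C_; nCn≡1; nCk≡n!/k![n-k]!; k![n∸k]!∣n!)
  import Data.Nat.DivMod as ℕDM
  open import Data.Nat.DivMod using (m/n*n≡m)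
  open import Data.Integer as ℤ using (ℤ; +_; -_; _+_; _*_; _-_; _^_; 0ℤ; 1ℤ)
  import Data.Integer.Properties as ℤP
  open import Data.Integer.Divisibility.Signed
    using (_∣_; divides; ∣m∣n⇒∣m+n; ∣m⇒∣-m; ∣-trans; ∣m⇒∣m*n; ∣n⇒∣m*n; ∣ᵤ⇒∣; ∣⇒∣ᵤ)
  open import Data.Integer.DivMod using (_%ℕ_; _/ℕ_; a≡a%ℕn+[a/ℕn]*n; n%ℕd<d)
  open import Data.Integer.Tactic.RingSolver using (solve-∀)
  open import Data.Fin as Fin using (toℕ; inject₁)
  import Data.Fin.Properties as FinP
  open import Data.Vec.Functional using (Vector; tail; init; last)
  open import Data.Sum using (_⊎_; inj₁; inj₂)
  open import Data.Product using (Σ; _,_)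
  open import Data.Bool as Bool using (Bool; true; false; if_then_else_)
  open import Data.Bool.ListAction using (any)
  open import Data.List using (upTo)
  open import Data.List.Relation.Unary.Any.Properties using (any⁺; any⁻)
  open import Data.List.Membership.Propositional using (find; lose)
  open import Data.List.Membership.Propositional.Properties using (∈-upTo⁺)
  open import Relation.Nullary using (¬_; contradiction)
  open import Relation.Binary.Bundles using (Setoid)
  import Relation.Binary.Reasoning.Setoid as SetoidReasoning
  open import Relation.Binary.PropositionalEquality
  open import Function using (_∘_; id)
  import Algebra.Properties.CommutativeSemiring.Binomial ℤP.+-*-commutativeSemiring as Binomial
  import Algebra.Properties.Semiring.Exp ℤP.+-*-semiring as SemiringExp
  import Algebra.Properties.CommutativeSemiring.Exp ℤP.+-*-commutativeSemiring as CommutativeSemiringExp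
  import Algebra.Properties.Monoid.Mult ℤP.+-0-monoid as MonoidMult
  open import Algebra.Properties.Monoid.Sum ℤP.+-0-monoid using (sum; sum-init-last)

  -- Congruence of integers modulo m: m divides the difference.  (A record
  -- rather than a synonym, so that a, b and m can be inferred from it.)
  infix 4 _≡_mod_
  record _≡_mod_ (a b m : ℤ) : Set where
    constructor mod-by
    field divides-difference : m ∣ a - b

  module _ {m : ℤ} where

    mod-by-identity : ∀ {x c d} → x ≡ c - d → m ∣ x → c ≡ d mod m
    mod-by-identity x≡c-d m∣x = mod-by (subst (m ∣_) x≡c-d m∣x)

    mod-reflexive : ∀ {a b} → a ≡ b → a ≡ b mod m
    mod-reflexive {a} refl = mod-by (divides 0ℤ (trans (ℤP.+-inverseʳ a) (sym (ℤP.*-zeroˡ m))))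

    mod-refl : ∀ {a} → a ≡ a mod m
    mod-refl = mod-reflexive refl

    mod-sym : ∀ {a b} → a ≡ b mod m → b ≡ a mod m
    mod-sym {a} {b} (mod-by a≡b) = mod-by-identity (lemma a b) (∣m⇒∣-m a≡b)
      where lemma : ∀ a b → - (a - b) ≡ b - a
            lemma = solve-∀

    mod-trans : ∀ {a b c} → a ≡ b mod m → b ≡ c mod m → a ≡ c mod m
    mod-trans {a} {b} {c} (mod-by a≡b) (mod-by b≡c) =
      mod-by-identity (lemma a b c) (∣m∣n⇒∣m+n a≡b b≡c)
      where lemma : ∀ a b c → a - b + (b - c) ≡ a - c
            lemma = solve-∀

    mod-+ : ∀ {a b c d} → a ≡ b mod m → c ≡ d mod m → a + c ≡ b + d mod m
    mod-+ {a} {b} {c} {d} (mod-by a≡b) (mod-by c≡d) =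
      mod-by-identity (lemma a b c d) (∣m∣n⇒∣m+n a≡b c≡d)
      where lemma : ∀ a b c d → a - b + (c - d) ≡ a + c - (b + d)
            lemma = solve-∀

    mod-neg : ∀ {a b} → a ≡ b mod m → - a ≡ - b mod m
    mod-neg {a} {b} (mod-by a≡b) = mod-by-identity (lemma a b) (∣m⇒∣-m a≡b)
      where lemma : ∀ a b → - (a - b) ≡ - a - - b
            lemma = solve-∀

    mod-- : ∀ {a b c d} → a ≡ b mod m → c ≡ d mod m → a - c ≡ b - d mod m
    mod-- a≡b c≡d = mod-+ a≡b (mod-neg c≡d)

    mod-* : ∀ {a b c d} → a ≡ b mod m → c ≡ d mod m → a * c ≡ b * d mod m
    mod-* {a} {b} {c} {d} (mod-by a≡b) (mod-by c≡d) =
      mod-by-identity (lemma a b c d) (∣m∣n⇒∣m+n (∣m⇒∣m*n c a≡b) (∣n⇒∣m*n b c≡d))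
      where lemma : ∀ a b c d → (a - b) * c + b * (c - d) ≡ a * c - b * d
            lemma = solve-∀

    mod-^ : ∀ {a b} n → a ≡ b mod m → a ^ n ≡ b ^ n mod m
    mod-^ zero    _   = mod-refl
    mod-^ (suc n) a≡b = mod-* a≡b (mod-^ n a≡b)

    ∣⇒≡0 : ∀ {a} → m ∣ a → a ≡ 0ℤ mod m
    ∣⇒≡0 {a} = mod-by-identity (sym (ℤP.+-identityʳ a))

  mod-setoid : ℤ → Setoid _ _
  mod-setoid m = record
    { Carrier = ℤ
    ; _≈_ = λ a b → a ≡ b mod m
    ; isEquivalence = record { refl = mod-refl ; sym = mod-sym ; trans = mod-trans }
    }

  module mod-Reasoning (m : ℤ) = SetoidReasoning (mod-setoid m)

  mod-divisor : ∀ {d m a b} → d ∣ m → a ≡ b mod m → a ≡ b mod d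
  mod-divisor d∣m (mod-by m∣a-b) = mod-by (∣-trans d∣m m∣a-b)

  %ℕ-mod : ∀ p .{{_ : NonZero p}} a → a ≡ + (a %ℕ p) mod + p
  %ℕ-mod p a = mod-by (divides (a /ℕ p) (lemma a (+ (a %ℕ p)) (a /ℕ p) (+ p) (a≡a%ℕn+[a/ℕn]*n a p)))
    where
    lemma : ∀ a r q p → a ≡ r + q * p → a - r ≡ q * p
    lemma a r q p refl = cancel r q p
      where cancel : ∀ r q p → r + q * p - r ≡ q * p
            cancel = solve-∀

  ∣∧<⇒≡0 : ∀ {p d} → p ℕD.∣ d → d < p → d ≡ 0
  ∣∧<⇒≡0 {d = zero}  _   _   = refl
  ∣∧<⇒≡0 {d = suc d} p∣d d<p = contradiction (ℕD.∣⇒≤ p∣d) (ℕP.<⇒≱ d<p)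

  residue-unique : ∀ {p r r'} → r < p → r' < p → + r ≡ + r' mod + p → r ≡ r'
  residue-unique {p} {r} {r'} r<p r'<p (mod-by p∣r-r') =
    ℤP.+-injective (ℤP.i-j≡0⇒i≡j (+ r) (+ r') (ℤP.∣i∣≡0⇒i≡0 distance≡0))
    where
    distance<p : ℤ.∣ + r - + r' ∣ < p
    distance<p = ℕP.≤-<-trans (ℕP.≤-reflexive (cong ℤ.∣_∣ (ℤP.m-n≡m⊖n r r')))
                   (ℕP.≤-<-trans (ℤP.∣m⊝n∣≤m⊔n r r') (ℕP.⊔-lub r<p r'<p))
    distance≡0 : ℤ.∣ + r - + r' ∣ ≡ 0
    distance≡0 = ∣∧<⇒≡0 (∣⇒∣ᵤ p∣r-r') distance<p

  mod⇒%ℕ : ∀ {p} .{{_ : NonZero p}} {a b} → a ≡ b mod + p → a %ℕ p ≡ b %ℕ p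
  mod⇒%ℕ {p} {a} {b} a≡b = residue-unique (n%ℕd<d a p) (n%ℕd<d b p)
    (mod-trans (mod-sym (%ℕ-mod p a)) (mod-trans a≡b (%ℕ-mod p b)))

  prime-∣-* : ∀ {p} → Prime p → ∀ a b → + p ∣ a * b → + p ∣ a ⊎ + p ∣ b
  prime-∣-* p-prime a b p∣ab
    with euclidsLemma ℤ.∣ a ∣ ℤ.∣ b ∣ p-prime (subst (ℕD._∣_ _) (ℤP.abs-* a b) (∣⇒∣ᵤ p∣ab))
  ... | inj₁ p∣a = inj₁ (∣ᵤ⇒∣ p∣a)
  ... | inj₂ p∣b = inj₂ (∣ᵤ⇒∣ p∣b)

  prime∤! : ∀ {p} → Prime p → ∀ {m} → m < p → ¬ p ℕD.∣ m !
  prime∤! p-prime {zero}  _   p∣1 = ¬prime[1] (subst Prime (ℕD.∣1⇒≡1 p∣1) p-prime)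
  prime∤! p-prime {suc m} m<p p∣m! with euclidsLemma (suc m) (m !) p-prime p∣m!
  ... | inj₁ p∣1+m = ℕP.<⇒≱ m<p (ℕD.∣⇒≤ p∣1+m)
  ... | inj₂ p∣m!  = prime∤! p-prime (ℕP.<-trans (ℕP.n<1+n m) m<p) p∣m!

  -- A prime p divides the binomial coefficients (p choose k) for 0 < k < p,
  -- because p divides p! = (p choose k) · k! · (p - k)! but neither factorial.
  prime∣binomial : ∀ {p k} → Prime p → 0 < k → k < p → p ℕD.∣ p C k
  prime∣binomial {suc n} {k} p-prime 0<k k<p
    with euclidsLemma (p C k) (k ! ℕ.* (p ∸ k) !) p-prime
           (subst (ℕD._∣_ p) (sym factorials) (ℕD.m∣m*n (n !)))
    where
    p = suc n
    factorials : (p C k) ℕ.* (k ! ℕ.* (p ∸ k) !) ≡ p !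
    factorials = trans (cong (ℕ._* (k ! ℕ.* (p ∸ k) !)) (nCk≡n!/k![n-k]! (ℕP.<⇒≤ k<p)))
                       (m/n*n≡m {{ℕP._!*_!≢0 k (p ∸ k)}} (k![n∸k]!∣n! (ℕP.<⇒≤ k<p)))
  ... | inj₁ p∣C = p∣C
  ... | inj₂ p∣k![p-k]! with euclidsLemma (k !) ((suc n ∸ k) !) p-prime p∣k![p-k]!
  ...   | inj₁ p∣k!     = contradiction p∣k! (prime∤! p-prime k<p)
  ...   | inj₂ p∣[p-k]! = contradiction p∣[p-k]! (prime∤! p-prime (ℕP.∸-monoʳ-< 0<k (ℕP.<⇒≤ k<p)))

  prime-odd : ∀ {p} → Prime p → 2 < p → Σ ℕ λ h → p ≡ suc (h ℕ.* 2)
  prime-odd {p} p-prime 2<p with p ℕ.% 2 | ℕDM.m≡m%n+[m/n]*n p 2 | ℕDM.m%n<n p 2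
  ... | 0 | p≡q*2 | _ with prime⇒irreducible p-prime (ℕD.divides (p ℕ./ 2) p≡q*2)
  ...   | inj₁ ()
  ...   | inj₂ 2≡p = contradiction (subst (2 <_) (sym 2≡p) 2<p) (ℕP.<-irrefl refl)
  prime-odd {p} p-prime 2<p | 1           | p≡1+q*2 | _ = p ℕ./ 2 , p≡1+q*2
  prime-odd {p} p-prime 2<p | suc (suc _) | _       | s<s (s<s ())

  semiring-^ : ∀ x n → x SemiringExp.^ n ≡ x ^ n
  semiring-^ x zero    = refl
  semiring-^ x (suc n) = cong (_*_ x) (semiring-^ x n)

  monoid-× : ∀ n x → n MonoidMult.× x ≡ + n * x
  monoid-× zero    x = sym (ℤP.*-zeroˡ x)
  monoid-× (suc n) x = trans (cong (_+_ x) (monoid-× n x)) (lemma (+ n) x)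
    where lemma : ∀ n x → x + n * x ≡ (1ℤ + n) * x
          lemma = solve-∀

  ∣-sum : ∀ {d n} (t : Vector ℤ n) → (∀ i → d ∣ t i) → d ∣ sum t
  ∣-sum {n = zero}  t d∣t = divides 0ℤ refl
  ∣-sum {n = suc n} t d∣t = ∣m∣n⇒∣m+n (d∣t Fin.zero) (∣-sum (tail t) (d∣t ∘ Fin.suc))

  -- By the binomial theorem (x + y)^p
  -- is y^p + x^p plus the terms (p choose k)·x^k·y^(p-k), 0 < k < p, and p
  -- divides each of those binomial coefficients.
  frobenius : ∀ {p} → Prime p → ∀ x y → (x + y) ^ p ≡ x ^ p + y ^ p mod + p
  frobenius {suc n} p-prime x y = mod-by-identity difference (∣-sum middle middle-divisible)
    where
    p = suc n
    term : Vector ℤ (suc p)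
    term k = (p C toℕ k) MonoidMult.× (x SemiringExp.^ toℕ k * y SemiringExp.^ (p ∸ toℕ k))
    middle : Vector ℤ n
    middle = init (tail term)

    first : term Fin.zero ≡ y ^ p
    first = trans (ℤP.+-identityʳ _) (trans (ℤP.*-identityˡ _) (semiring-^ y p))

    final : last (tail term) ≡ x ^ p
    final rewrite FinP.toℕ-fromℕ n | nCn≡1 p | ℕP.n∸n≡0 p =
      trans (ℤP.+-identityʳ _) (trans (ℤP.*-identityʳ _) (semiring-^ x p))

    expansion : (x + y) ^ p ≡ y ^ p + (sum middle + x ^ p)
    expansion = begin
      (x + y) ^ p                                     ≡⟨ sym (semiring-^ (x + y) p) ⟩
      (x + y) SemiringExp.^ p                         ≡⟨ Binomial.theorem p x y ⟩
      term Fin.zero + sum (tail term)                 ≡⟨ cong (_+_ (term Fin.zero)) (sum-init-last (tail term)) ⟩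
      term Fin.zero + (sum middle + last (tail term)) ≡⟨ cong₂ (λ a b → a + (sum middle + b)) first final ⟩
      y ^ p + (sum middle + x ^ p)                    ∎
      where open ≡-Reasoning

    difference : sum middle ≡ (x + y) ^ p - (x ^ p + y ^ p)
    difference = trans (lemma (sum middle) (x ^ p) (y ^ p)) (cong (_- (x ^ p + y ^ p)) (sym expansion))
      where lemma : ∀ m X Y → m ≡ Y + (m + X) - (X + Y)
            lemma = solve-∀

    middle-divisible : ∀ i → + p ∣ middle i
    middle-divisible i = subst (+ p ∣_) (sym (monoid-× (p C k) _))
      (∣m⇒∣m*n {m = + (p C k)} _ (∣ᵤ⇒∣ {+ p} {+ (p C k)} (prime∣binomial p-prime z<s (s<s k<n))))
      where
      k = suc (toℕ (inject₁ i))
      k<n : toℕ (inject₁ i) < n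
      k<n = subst (_< n) (sym (FinP.toℕ-inject₁ i)) (FinP.toℕ<n i)

  -- Fermat's little theorem for natural numbers, x^p ≡ x (mod p): induction on
  -- x, the step being Frobenius applied to x + 1.
  fermat-little : ∀ {p} → Prime p → ∀ x → (+ x) ^ p ≡ + x mod + p
  fermat-little {zero}  p-prime         = contradiction p-prime ¬prime[0]
  fermat-little {suc n} p-prime zero    = mod-reflexive (ℤP.*-zeroˡ (0ℤ ^ n))
  fermat-little {suc n} p-prime (suc x) = begin
    (+ suc x) ^ p           ≡⟨ cong (_^ p) (ℤP.pos-+ 1 x) ⟩
    (1ℤ + + x) ^ p          ≈⟨ frobenius p-prime 1ℤ (+ x) ⟩
    1ℤ ^ p + (+ x) ^ p      ≈⟨ mod-+ (mod-reflexive (ℤP.^-zeroˡ p)) (fermat-little p-prime x) ⟩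
    1ℤ + + x                ≡⟨ sym (ℤP.pos-+ 1 x) ⟩
    + suc x                 ∎
    where
    p = suc n
    open mod-Reasoning (+ p)

  -- Fermat's little theorem in the form u^(p-1) ≡ 1 (mod p) for p ∤ u: p divides
  -- u^p - u = u·(u^(p-1) - 1), hence by Euclid's lemma the second factor.
  fermat : ∀ {p} → Prime p → ∀ {u} → ¬ p ℕD.∣ u → (+ u) ^ (p ∸ 1) ≡ 1ℤ mod + p
  fermat {zero}  p-prime _ = contradiction p-prime ¬prime[0]
  fermat {suc n} p-prime {u} p∤u
    with prime-∣-* p-prime (+ u) ((+ u) ^ n - 1ℤ)
           (subst (+ suc n ∣_) (factor (+ u) ((+ u) ^ n))
                  (_≡_mod_.divides-difference (fermat-little p-prime u)))
    where factor : ∀ u U → u * U - u ≡ u * (U - 1ℤ)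
          factor = solve-∀
  ... | inj₁ p∣u = contradiction (∣⇒∣ᵤ p∣u) p∤u
  ... | inj₂ p∣uⁿ-1 = mod-by p∣uⁿ-1

  pos-^ : ∀ m n → + (m ℕ.^ n) ≡ (+ m) ^ n
  pos-^ m zero    = refl
  pos-^ m (suc n) = trans (ℤP.pos-* m (m ℕ.^ n)) (cong (_*_ (+ m)) (pos-^ m n))

  ^-distrib-* : ∀ x y n → (x * y) ^ n ≡ x ^ n * y ^ n
  ^-distrib-* x y n = trans (sym (semiring-^ (x * y) n))
    (trans (CommutativeSemiringExp.^-distrib-* x y n) (cong₂ _*_ (semiring-^ x n) (semiring-^ y n)))

  neg-^-odd : ∀ x h → (- x) ^ suc (h ℕ.* 2) ≡ - (x ^ suc (h ℕ.* 2))
  neg-^-odd x zero    = lemma x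
    where lemma : ∀ x → - x * 1ℤ ≡ - (x * 1ℤ)
          lemma = solve-∀
  neg-^-odd x (suc h) = trans (cong (λ z → - x * (- x * z)) (neg-^-odd x h)) (lemma x (x ^ suc (h ℕ.* 2)))
    where lemma : ∀ x X → - x * (- x * - X) ≡ - (x * (x * X))
          lemma = solve-∀

  neg-^-prime : ∀ {p} → Prime p → 2 < p → ∀ x → (- x) ^ p ≡ - (x ^ p)
  neg-^-prime p-prime 2<p x with h , refl ← prime-odd p-prime 2<p = neg-^-odd x h

  first-order : ∀ y d n → (y + d) ^ suc n ≡ y ^ suc n + + suc n * d * y ^ n mod d * d
  first-order y d zero    = mod-reflexive (base y d)
    where base : ∀ y d → (y + d) * 1ℤ ≡ y * 1ℤ + 1ℤ * d * 1ℤ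
          base = solve-∀
  first-order y d (suc n) =
    mod-trans (mod-* (mod-refl {a = y + d}) (first-order y d n))
              (mod-by-identity (step y d (y ^ n) (+ suc n)) (divides (+ suc n * y ^ n) refl))
    where step : ∀ y d Y N → N * Y * (d * d)
                   ≡ (y + d) * (y * Y + N * d * Y) - (y * (y * Y) + (1ℤ + N) * d * (y * Y))
          step = solve-∀

  square-∣ : ∀ {m d} → m ∣ d → m * m ∣ d * d
  square-∣ {m} (divides q refl) = divides (q * q) (lemma q m)
    where lemma : ∀ q m → q * m * (q * m) ≡ q * q * (m * m)
          lemma = solve-∀

  pow-lift : ∀ m {x y} → x ≡ y mod + m → x ^ m ≡ y ^ m mod + m * + m
  pow-lift zero    _                   = mod-refl
  pow-lift (suc n) {x} {y} (mod-by m∣d@(divides k d≡kM)) = begin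
    x ^ M                       ≡⟨ cong (_^ M) (x≡y+d x y) ⟩
    (y + d) ^ M                 ≈⟨ mod-divisor (square-∣ m∣d) (first-order y d n) ⟩
    y ^ M + + M * d * y ^ n     ≈⟨ mod-+ (mod-refl {a = y ^ M}) (∣⇒≡0 m²∣Mdyⁿ) ⟩
    y ^ M + 0ℤ                  ≡⟨ ℤP.+-identityʳ (y ^ M) ⟩
    y ^ M                       ∎
    where
    M = suc n
    d = x - y
    open mod-Reasoning (+ M * + M)
    x≡y+d : ∀ x y → x ≡ y + (x - y)
    x≡y+d = solve-∀
    m²∣Mdyⁿ : + M * + M ∣ + M * d * y ^ n
    m²∣Mdyⁿ = divides (k * y ^ n) (trans (cong (λ e → + M * e * y ^ n) d≡kM) (lemma (+ M) k (y ^ n)))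
      where lemma : ∀ M k Y → M * (k * M) * Y ≡ k * Y * (M * M)
            lemma = solve-∀

  geometric : ∀ {m x} n → x ≡ 1ℤ mod m → x ^ n - 1ℤ ≡ + n * (x - 1ℤ) mod m * m
  geometric {m} {x} zero    _            = mod-reflexive (lemma x)
    where lemma : ∀ x → 1ℤ - 1ℤ ≡ 0ℤ * (x - 1ℤ)
          lemma = solve-∀
  geometric {m} {x} (suc n) (mod-by m∣d) = begin
    x ^ suc n - 1ℤ                         ≡⟨ cong (λ z → z ^ suc n - 1ℤ) (x≡1+d x) ⟩
    (1ℤ + d) ^ suc n - 1ℤ
      ≈⟨ mod-- (mod-divisor (square-∣ m∣d) (first-order 1ℤ d n)) (mod-refl {a = 1ℤ}) ⟩
    1ℤ ^ suc n + + suc n * d * 1ℤ ^ n - 1ℤ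
      ≡⟨ cong₂ (λ a b → a + + suc n * d * b - 1ℤ) (ℤP.^-zeroˡ (suc n)) (ℤP.^-zeroˡ n) ⟩
    1ℤ + + suc n * d * 1ℤ - 1ℤ             ≡⟨ lemma (+ suc n) d ⟩
    + suc n * d                            ∎
    where
    d = x - 1ℤ
    open mod-Reasoning (m * m)
    x≡1+d : ∀ x → x ≡ 1ℤ + (x - 1ℤ)
    x≡1+d = solve-∀
    lemma : ∀ N d → 1ℤ + N * d * 1ℤ - 1ℤ ≡ N * d
    lemma = solve-∀

  mod-*-lift : ∀ {m a a' z} → a ≡ a' mod m → z ≡ 0ℤ mod m → a * z ≡ a' * z mod m * m
  mod-*-lift {m} {a} {a'} {z} (mod-by (divides q a-a'≡qm)) (mod-by (divides r z-0≡rm)) =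
    mod-by (divides (q * r) (begin
      a * z - a' * z         ≡⟨ factor a a' z ⟩
      (a - a') * (z - 0ℤ)    ≡⟨ cong₂ _*_ a-a'≡qm z-0≡rm ⟩
      q * m * (r * m)        ≡⟨ regroup q r m ⟩
      q * r * (m * m)        ∎))
    where
    open ≡-Reasoning
    factor : ∀ a a' z → a * z - a' * z ≡ (a - a') * (z - 0ℤ)
    factor = solve-∀
    regroup : ∀ q r m → q * m * (r * m) ≡ q * r * (m * m)
    regroup = solve-∀

  cancel-mod : ∀ {m x y} .{{_ : ℤ.NonZero m}} → m * x ≡ m * y mod m * m → x ≡ y mod m
  cancel-mod {m} {x} {y} (mod-by (divides q eq)) =
    mod-by (divides q (ℤP.*-cancelˡ-≡ m (x - y) (q * m)
      (trans (factor m x y) (trans eq (regroup q m)))))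
    where
    factor : ∀ m x y → m * (x - y) ≡ m * x - m * y
    factor = solve-∀
    regroup : ∀ q m → q * (m * m) ≡ m * (q * m)
    regroup = solve-∀

  last-digit : ∀ p .{{_ : NonZero p}} c → + (p ℕ.* (c ℕ.% p)) ≡ + (c ℕ.* p) mod + p * + p
  last-digit p c = mod-sym (mod-by-identity identity (divides (+ (c ℕ./ p)) refl))
    where
    r = c ℕ.% p
    q = c ℕ./ p
    c≡r+qp : + c ≡ + r + + q * + p
    c≡r+qp = trans (cong +_ (ℕDM.m≡m%n+[m/n]*n c p))
                   (trans (ℤP.pos-+ r (q ℕ.* p)) (cong (_+_ (+ r)) (ℤP.pos-* q p)))
    lemma : ∀ c r q p → c ≡ r + q * p → q * (p * p) ≡ c * p - p * r
    lemma .(r + q * p) r q p refl = expand r q p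
      where expand : ∀ r q p → q * (p * p) ≡ (r + q * p) * p - p * r
            expand = solve-∀
    identity : + q * (+ p * + p) ≡ + (c ℕ.* p) - + (p ℕ.* r)
    identity = trans (lemma (+ c) (+ r) (+ q) (+ p) c≡r+qp)
                     (sym (cong₂ _-_ (ℤP.pos-* c p) (ℤP.pos-* p r)))

  fermatQuotient-spec : ∀ p .{{_ : NonZero p}} {v} → 1 ≤ v → (+ v) ^ (p ∸ 1) ≡ 1ℤ mod + p →
    + p * + fermatQuotient p v ≡ (+ v) ^ (p ∸ 1) - 1ℤ mod + p * + p
  fermatQuotient-spec p {v} 1≤v (mod-by p∣V-1) = begin
    + p * + fermatQuotient p v         ≡⟨ cong (λ r → + p * + r) q≡c%p ⟩
    + p * + (c ℕ.% p)                  ≡⟨ sym (ℤP.pos-* p (c ℕ.% p)) ⟩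
    + (p ℕ.* (c ℕ.% p))                ≈⟨ last-digit p c ⟩
    + (c ℕ.* p)                        ≡⟨ cong +_ (sym V∸1≡cp) ⟩
    + (V ∸ 1)                          ≡⟨ sym V-1≡V∸1 ⟩
    (+ v) ^ (p ∸ 1) - 1ℤ               ∎
    where
    open mod-Reasoning (+ p * + p)
    V = v ℕ.^ (p ∸ 1)
    V-1≡V∸1 : (+ v) ^ (p ∸ 1) - 1ℤ ≡ + (V ∸ 1)
    V-1≡V∸1 = trans (cong (_- 1ℤ) (sym (pos-^ v (p ∸ 1))))
                (trans (ℤP.m-n≡m⊖n V 1) (ℤP.⊖-≥ (ℕP.m^n>0 v {{ℕ.>-nonZero 1≤v}} (p ∸ 1))))
    p∣V∸1 : p ℕD.∣ V ∸ 1
    p∣V∸1 = ∣⇒∣ᵤ (subst (+ p ∣_) V-1≡V∸1 p∣V-1)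
    c = ℕD.quotient p∣V∸1
    V∸1≡cp : V ∸ 1 ≡ c ℕ.* p
    V∸1≡cp = ℕD._∣_.equality p∣V∸1
    q≡c%p : fermatQuotient p v ≡ c ℕ.% p
    q≡c%p = trans (cong (λ x → (x ℕ./ p) ℕ.% p) V∸1≡cp) (cong (ℕ._% p) (ℕDM.m*n/n≡m c p))

  -- For p ∤ u:  p·q_p(u^u) ≡ u·(u^(p-1) - 1) (mod p²).  Writing w = u^(p-1) ≡ 1,
  -- we have (u^u)^(p-1) = w^u and w^u - 1 ≡ u·(w - 1) modulo p².
  fermatQuotient-self-power : ∀ {p} .{{_ : NonZero p}} → Prime p → ∀ {u} → ¬ p ℕD.∣ u →
    + p * + fermatQuotient p (u ℕ.^ u) ≡ + u * ((+ u) ^ (p ∸ 1) - 1ℤ) mod + p * + p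
  fermatQuotient-self-power {p} p-prime {zero}      p∤u = contradiction (ℕD._∣0 p) p∤u
  fermatQuotient-self-power {p} p-prime {u@(suc _)} p∤u = begin
    + p * + fermatQuotient p (u ℕ.^ u) ≈⟨ fermatQuotient-spec p (ℕP.m^n>0 u u) vᵖ⁻¹≡1 ⟩
    (+ (u ℕ.^ u)) ^ (p ∸ 1) - 1ℤ       ≡⟨ cong (_- 1ℤ) vᵖ⁻¹≡wᵘ ⟩
    w ^ u - 1ℤ                          ≈⟨ geometric u w≡1 ⟩
    + u * (w - 1ℤ)                      ∎
    where
    open mod-Reasoning (+ p * + p)
    w = (+ u) ^ (p ∸ 1)
    w≡1 : w ≡ 1ℤ mod + p
    w≡1 = fermat p-prime p∤u
    vᵖ⁻¹≡wᵘ : (+ (u ℕ.^ u)) ^ (p ∸ 1) ≡ w ^ u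
    vᵖ⁻¹≡wᵘ = trans (cong (_^ (p ∸ 1)) (pos-^ u u))
             (trans (ℤP.^-*-assoc (+ u) u (p ∸ 1))
             (trans (cong ((+ u) ^_) (ℕP.*-comm u (p ∸ 1)))
                    (sym (ℤP.^-*-assoc (+ u) (p ∸ 1) u))))
    vᵖ⁻¹≡1 : (+ (u ℕ.^ u)) ^ (p ∸ 1) ≡ 1ℤ mod + p
    vᵖ⁻¹≡1 = mod-trans (mod-reflexive vᵖ⁻¹≡wᵘ)
               (mod-trans (mod-^ u w≡1) (mod-reflexive (ℤP.^-zeroˡ u)))

  T-ext : ∀ {x y : Bool} → (Bool.T x → Bool.T y) → (Bool.T y → Bool.T x) → x ≡ y
  T-ext {false} {false} _   _   = refl
  T-ext {false} {true}  _   y⇒x = contradiction (y⇒x _) id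
  T-ext {true}  {false} x⇒y _   = contradiction (x⇒y _) id
  T-ext {true}  {true}  _   _   = refl

  -- The two tests in the definition of the Legendre symbol (a / p): whether
  -- p ∣ a, and whether a is a square modulo p.  Both are preserved under
  -- multiplication by squares, so (a / p) only depends on a up to square factors.
  module _ (p : ℕ) .{{_ : NonZero p}} where

    divisible : ℤ → Bool
    divisible a = a %ℕ p ℕ.≡ᵇ 0

    square : ℤ → Bool
    square a = any (λ y → (y ℕ.* y) ℕ.% p ℕ.≡ᵇ a %ℕ p) (upTo p)

    divisible-transfer : ∀ {a b} c → a ≡ c * b mod + p → Bool.T (divisible b) → Bool.T (divisible a)
    divisible-transfer {a} {b} c a≡cb p∣b =
      ℕP.≡⇒≡ᵇ _ 0 (trans (mod⇒%ℕ a≡0) (ℕDM.m<n⇒m%n≡m (ℕ.>-nonZero⁻¹ p)))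
      where
      open mod-Reasoning (+ p)
      a≡0 : a ≡ 0ℤ mod + p
      a≡0 = begin
        a              ≈⟨ a≡cb ⟩
        c * b          ≈⟨ mod-* (mod-refl {a = c}) (%ℕ-mod p b) ⟩
        c * + (b %ℕ p) ≡⟨ cong (λ r → c * + r) (ℕP.≡ᵇ⇒≡ _ 0 p∣b) ⟩
        c * 0ℤ         ≡⟨ ℤP.*-zeroʳ c ⟩
        0ℤ             ∎

    -- If b ≡ y² then a ≡ c²·b ≡ (c·y)², and c·y may be reduced below p.
    square-transfer : ∀ {a b} c → a ≡ + (c ℕ.* c) * b mod + p → Bool.T (square b) → Bool.T (square a)
    square-transfer {a} {b} c a≡c²b b-square
      with y , y<p , y²≡b ← find (any⁻ _ (upTo p) b-square)
      = any⁺ _ (lose (∈-upTo⁺ (ℕDM.m%n<n (c ℕ.* y) p)) (ℕP.≡⇒≡ᵇ _ _ (mod⇒%ℕ cy²≡a)))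
      where
      open mod-Reasoning (+ p)
      cy = (c ℕ.* y) ℕ.% p
      cy²≡a : + (cy ℕ.* cy) ≡ a mod + p
      cy²≡a = begin
        + (cy ℕ.* cy)                  ≡⟨ ℤP.pos-* cy cy ⟩
        + cy * + cy                    ≈⟨ mod-* cy≡c*y cy≡c*y ⟩
        + (c ℕ.* y) * + (c ℕ.* y)      ≡⟨ regroup c y ⟩
        + (c ℕ.* c) * + (y ℕ.* y)      ≈⟨ mod-* (mod-refl {a = + (c ℕ.* c)}) (%ℕ-mod p (+ (y ℕ.* y))) ⟩
        + (c ℕ.* c) * + ((y ℕ.* y) ℕ.% p) ≡⟨ cong (λ r → + (c ℕ.* c) * + r) (ℕP.≡ᵇ⇒≡ _ _ y²≡b) ⟩
        + (c ℕ.* c) * + (b %ℕ p)       ≈⟨ mod-* (mod-refl {a = + (c ℕ.* c)}) (mod-sym (%ℕ-mod p b)) ⟩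
        + (c ℕ.* c) * b                ≈⟨ mod-sym a≡c²b ⟩
        a                              ∎
        where
        cy≡c*y : + cy ≡ + (c ℕ.* y) mod + p
        cy≡c*y = mod-sym (%ℕ-mod p (+ (c ℕ.* y)))
        regroup : ∀ c y → + (c ℕ.* y) * + (c ℕ.* y) ≡ + (c ℕ.* c) * + (y ℕ.* y)
        regroup c y = trans (cong₂ _*_ (ℤP.pos-* c y) (ℤP.pos-* c y))
          (trans (lemma (+ c) (+ y)) (sym (cong₂ _*_ (ℤP.pos-* c c) (ℤP.pos-* y y))))
          where lemma : ∀ c y → c * y * (c * y) ≡ c * c * (y * y)
                lemma = solve-∀

    legendre-square-transfer : ∀ {a b} c d → a ≡ + (c ℕ.* c) * b mod + p →
      b ≡ + (d ℕ.* d) * a mod + p → legendre p a ≡ legendre p b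
    legendre-square-transfer c d a≡c²b b≡d²a =
      cong₂ (λ z q → if z then + 0 else (if q then + 1 else - (+ 1)))
        (T-ext (divisible-transfer (+ (d ℕ.* d)) b≡d²a) (divisible-transfer (+ (c ℕ.* c)) a≡c²b))
        (T-ext (square-transfer d b≡d²a) (square-transfer c a≡c²b))

  below-p : ∀ {p s} → 1 ≤ s → s ≤ p ∸ 2 → suc s < p
  below-p {suc (suc _)} _ s≤p-2 = s≤s (s≤s s≤p-2)
  below-p {zero}  {suc _} _ ()
  below-p {suc zero} {suc _} _ ()

  module _ {n : ℕ} (p-prime : Prime (suc n)) where

    private
      p = suc n
      P = + p

    coefficient : ℕ → ℤ
    coefficient s = + (2 ℕ.* s ℕ.* suc s)

    thetaArg : ℕ → ℤ
    thetaArg s = coefficient s * qRatio p s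

    defect : ℕ → ℤ
    defect s = (+ s) ^ p - (+ suc s) ^ p + 1ℤ

    defect≡0 : ∀ s → defect s ≡ 0ℤ mod P
    defect≡0 s = mod-trans (mod-+ (mod-- (fermat-little p-prime s) (fermat-little p-prime (suc s))) mod-refl)
                           (mod-reflexive (lemma (+ s)))
      where lemma : ∀ S → S - (1ℤ + S) + 1ℤ ≡ 0ℤ
            lemma = solve-∀

    ∤-small : ∀ {u} → 1 ≤ u → u < p → ¬ p ℕD.∣ u
    ∤-small {suc u} _ u<p p∣u = ℕP.<⇒≱ u<p (ℕD.∣⇒≤ p∣u)

    thetaArg-defect : ∀ {s} → 1 ≤ s → suc s < p → P * thetaArg s ≡ coefficient s * defect s mod P * P
    thetaArg-defect {s} 1≤s s+1<p = begin
      P * thetaArg s                      ≡⟨ distribute P (coefficient s) qₛ qₛ₊₁ ⟩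
      coefficient s * (P * qₛ - P * qₛ₊₁) ≈⟨ mod-* (mod-refl {a = coefficient s}) (mod-- pqₛ pqₛ₊₁) ⟩
      coefficient s * (+ s * ((+ s) ^ n - 1ℤ) - (1ℤ + + s) * ((1ℤ + + s) ^ n - 1ℤ))
                                          ≡⟨ cong (_*_ (coefficient s)) (collect (+ s) ((+ s) ^ n) ((1ℤ + + s) ^ n)) ⟩
      coefficient s * defect s            ∎
      where
      open mod-Reasoning (P * P)
      qₛ = + fermatQuotient p (s ℕ.^ s)
      qₛ₊₁ = + fermatQuotient p (suc s ℕ.^ suc s)
      pqₛ : P * qₛ ≡ + s * ((+ s) ^ n - 1ℤ) mod P * P
      pqₛ = fermatQuotient-self-power p-prime (∤-small 1≤s (ℕP.<-trans (ℕP.n<1+n s) s+1<p))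
      pqₛ₊₁ : P * qₛ₊₁ ≡ (1ℤ + + s) * ((1ℤ + + s) ^ n - 1ℤ) mod P * P
      pqₛ₊₁ = fermatQuotient-self-power p-prime (∤-small (s≤s z≤n) s+1<p)
      distribute : ∀ P C a b → P * (C * (a - b)) ≡ C * (P * a - P * b)
      distribute = solve-∀
      collect : ∀ S U V → S * (U - 1ℤ) - (1ℤ + S) * (V - 1ℤ) ≡ S * U - (1ℤ + S) * V + 1ℤ
      collect = solve-∀

    -- Transfer principle: if D(s') ≡ w·D(s) (mod p²) and the coefficients satisfy
    -- 2s'(s'+1)·w ≡ e·2s(s+1) (mod p), then thetaArg(s') ≡ e·thetaArg(s) (mod p).
    -- (Multiply by p, use the key congruence, and exploit D(s) ≡ 0 (mod p).)
    thetaArg-transfer : ∀ {s s'} w e → 1 ≤ s → suc s < p → 1 ≤ s' → suc s' < p →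
      defect s' ≡ w * defect s mod P * P → coefficient s' * w ≡ e * coefficient s mod P →
      thetaArg s' ≡ e * thetaArg s mod P
    thetaArg-transfer {s} {s'} w e 1≤s s+1<p 1≤s' s'+1<p D'≡wD C'w≡eC = cancel-mod (begin
      P * thetaArg s'                   ≈⟨ thetaArg-defect 1≤s' s'+1<p ⟩
      coefficient s' * defect s'        ≈⟨ mod-* (mod-refl {a = coefficient s'}) D'≡wD ⟩
      coefficient s' * (w * defect s)   ≡⟨ sym (ℤP.*-assoc (coefficient s') w (defect s)) ⟩
      coefficient s' * w * defect s     ≈⟨ mod-*-lift C'w≡eC (defect≡0 s) ⟩
      e * coefficient s * defect s      ≡⟨ ℤP.*-assoc e (coefficient s) (defect s) ⟩
      e * (coefficient s * defect s)    ≈⟨ mod-* (mod-refl {a = e}) (mod-sym (thetaArg-defect 1≤s s+1<p)) ⟩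
      e * (P * thetaArg s)              ≡⟨ swap e P (thetaArg s) ⟩
      P * (e * thetaArg s)              ∎)
      where
      open mod-Reasoning (P * P)
      swap : ∀ e P X → e * (P * X) ≡ P * (e * X)
      swap = solve-∀

    coefficient-expand : ∀ s → coefficient s ≡ + 2 * + s * (1ℤ + + s)
    coefficient-expand s = trans (ℤP.pos-* (2 ℕ.* s) (suc s)) (cong (_* (1ℤ + + s)) (ℤP.pos-* 2 s))

    module Reflection {s s'} (s'+[s+1]≡p : s' ℕ.+ suc s ≡ p) where

      private
        lemma : ∀ a b → a - - b ≡ a + b
        lemma = solve-∀
        sum≡P : + s' + (1ℤ + + s) ≡ P
        sum≡P = trans (sym (ℤP.pos-+ s' (suc s))) (cong +_ s'+[s+1]≡p)

      s'≡-[s+1] : + s' ≡ - (1ℤ + + s) mod P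
      s'≡-[s+1] = mod-by (divides 1ℤ (trans (lemma (+ s') (1ℤ + + s))
                                      (trans sum≡P (sym (ℤP.*-identityˡ P)))))

      s'+1≡-s : 1ℤ + + s' ≡ - + s mod P
      s'+1≡-s = mod-by (divides 1ℤ (trans (lemma (1ℤ + + s') (+ s))
                                    (trans (shift (+ s') (+ s)) (trans sum≡P (sym (ℤP.*-identityˡ P))))))
        where shift : ∀ a b → 1ℤ + a + b ≡ a + (1ℤ + b)
              shift = solve-∀

      defect-reflection : 2 < p → defect s' ≡ defect s mod P * P
      defect-reflection 2<p = begin
        (+ s') ^ p - (1ℤ + + s') ^ p + 1ℤ
          ≈⟨ mod-+ (mod-- (pow-lift p s'≡-[s+1]) (pow-lift p s'+1≡-s)) (mod-refl {a = 1ℤ}) ⟩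
        (- (1ℤ + + s)) ^ p - (- + s) ^ p + 1ℤ
          ≡⟨ cong₂ (λ a b → a - b + 1ℤ) (neg-^-prime p-prime 2<p (1ℤ + + s)) (neg-^-prime p-prime 2<p (+ s)) ⟩
        - (1ℤ + + s) ^ p - - (+ s) ^ p + 1ℤ
          ≡⟨ rearrange ((1ℤ + + s) ^ p) ((+ s) ^ p) ⟩
        (+ s) ^ p - (1ℤ + + s) ^ p + 1ℤ   ∎
        where
        open mod-Reasoning (P * P)
        rearrange : ∀ A B → - A - - B + 1ℤ ≡ B - A + 1ℤ
        rearrange = solve-∀

      coefficient-reflection : coefficient s' ≡ coefficient s mod P
      coefficient-reflection = begin
        coefficient s'                 ≡⟨ coefficient-expand s' ⟩
        + 2 * + s' * (1ℤ + + s')       ≈⟨ mod-* (mod-* (mod-refl {a = + 2}) s'≡-[s+1]) s'+1≡-s ⟩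
        + 2 * - (1ℤ + + s) * - + s     ≡⟨ signs (+ s) ⟩
        + 2 * + s * (1ℤ + + s)         ≡⟨ sym (coefficient-expand s) ⟩
        coefficient s                  ∎
        where
        open mod-Reasoning P
        signs : ∀ S → + 2 * - (1ℤ + S) * - S ≡ + 2 * S * (1ℤ + S)
        signs = solve-∀

    module Inversion {s t} (st≡1 : (s ℕ.* t) ℕ.% p ≡ 1) where

      private
        S = + s
        T = + t

      st≡1ℤ : S * T ≡ 1ℤ mod P
      st≡1ℤ = mod-trans (mod-reflexive (sym (ℤP.pos-* s t)))
                (mod-trans (%ℕ-mod p (+ (s ℕ.* t))) (mod-reflexive (cong +_ st≡1)))

      -- t^p·D(s) = (st)^p - ((s+1)t)^p + t^p ≡ 1 - (1+t)^p + t^p = D(t)  (mod p²).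
      defect-inversion : defect t ≡ T ^ p * defect s mod P * P
      defect-inversion = mod-sym (begin
        T ^ p * defect s                       ≡⟨ expand ⟩
        (S * T) ^ p - ((1ℤ + S) * T) ^ p + T ^ p
          ≈⟨ mod-+ (mod-- (pow-lift p st≡1ℤ) (pow-lift p [s+1]t≡1+t)) (mod-refl {a = T ^ p}) ⟩
        1ℤ ^ p - (1ℤ + T) ^ p + T ^ p          ≡⟨ cong (λ o → o - (1ℤ + T) ^ p + T ^ p) (ℤP.^-zeroˡ p) ⟩
        1ℤ - (1ℤ + T) ^ p + T ^ p              ≡⟨ reorder (T ^ p) ((1ℤ + T) ^ p) ⟩
        defect t                               ∎)
        where
        open mod-Reasoning (P * P)
        [s+1]t≡1+t : (1ℤ + S) * T ≡ 1ℤ + T mod P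
        [s+1]t≡1+t = mod-trans (mod-reflexive (distribute S T)) (mod-+ st≡1ℤ (mod-refl {a = T}))
          where distribute : ∀ S T → (1ℤ + S) * T ≡ S * T + T
                distribute = solve-∀
        expand : T ^ p * defect s ≡ (S * T) ^ p - ((1ℤ + S) * T) ^ p + T ^ p
        expand = trans (multiply (T ^ p) (S ^ p) ((1ℤ + S) ^ p))
          (cong₂ (λ a b → a - b + T ^ p) (sym (^-distrib-* S T p)) (sym (^-distrib-* (1ℤ + S) T p)))
          where multiply : ∀ X A B → X * (A - B + 1ℤ) ≡ A * X - B * X + X
                multiply = solve-∀
        reorder : ∀ X Y → 1ℤ - Y + X ≡ X - Y + 1ℤ
        reorder = solve-∀

      -- 2t(t+1)·t^p ≡ 2t(t+1)·t ≡ t⁴·2s(s+1)  (mod p), using t^p ≡ t and st ≡ 1.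
      coefficient-inversion : coefficient t * T ^ p ≡ + (t ℕ.* t ℕ.* (t ℕ.* t)) * coefficient s mod P
      coefficient-inversion = begin
        coefficient t * T ^ p                        ≈⟨ mod-* (mod-refl {a = coefficient t}) (fermat-little p-prime t) ⟩
        coefficient t * T                            ≡⟨ cong (_* T) (coefficient-expand t) ⟩
        + 2 * T * (1ℤ + T) * T                       ≡⟨ regroup₁ T ⟩
        + 2 * T * T * 1ℤ * (1ℤ + T)                  ≈⟨ mod-sym (mod-* (mod-* (mod-refl {a = + 2 * T * T}) st≡1ℤ)
                                                                     (mod-+ st≡1ℤ (mod-refl {a = T}))) ⟩
        + 2 * T * T * (S * T) * (S * T + T)          ≡⟨ regroup₂ S T ⟩
        T * T * (T * T) * (+ 2 * S * (1ℤ + S))       ≡⟨ cong₂ _*_ t⁴ (sym (coefficient-expand s)) ⟩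
        + (t ℕ.* t ℕ.* (t ℕ.* t)) * coefficient s   ∎
        where
        open mod-Reasoning P
        regroup₁ : ∀ T → + 2 * T * (1ℤ + T) * T ≡ + 2 * T * T * 1ℤ * (1ℤ + T)
        regroup₁ = solve-∀
        regroup₂ : ∀ S T → + 2 * T * T * (S * T) * (S * T + T) ≡ T * T * (T * T) * (+ 2 * S * (1ℤ + S))
        regroup₂ = solve-∀
        t⁴ : T * T * (T * T) ≡ + (t ℕ.* t ℕ.* (t ℕ.* t))
        t⁴ = sym (trans (ℤP.pos-* (t ℕ.* t) (t ℕ.* t)) (cong₂ _*_ (ℤP.pos-* t t) (ℤP.pos-* t t)))

    theta-reflection : ∀ {s} → 1 ≤ s → s ≤ p ∸ 2 → theta p (p ∸ (1 ℕ.+ s)) ≡ theta p s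
    theta-reflection {s} 1≤s s≤p-2 = legendre-square-transfer p 1 1
      (transfer 1≤s s+1<p 1≤s' s'+1<p (ℕP.m∸n+n≡m (ℕP.<⇒≤ s+1<p)))
      (transfer 1≤s' s'+1<p 1≤s s+1<p s+[s'+1]≡p)
      where
      s' = p ∸ (1 ℕ.+ s)
      s+1<p = below-p 1≤s s≤p-2
      1≤s' : 1 ≤ s'
      1≤s' = ℕP.m<n⇒0<n∸m s+1<p
      s'+1<p = below-p 1≤s' (ℕP.∸-monoʳ-≤ p (s≤s 1≤s))
      s+[s'+1]≡p : s ℕ.+ suc s' ≡ p
      s+[s'+1]≡p = trans (ℕP.+-suc s s') (trans (cong suc (ℕP.+-comm s s'))
                     (trans (sym (ℕP.+-suc s' s)) (ℕP.m∸n+n≡m (ℕP.<⇒≤ s+1<p))))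
      2<p : 2 < p
      2<p = ℕP.≤-<-trans (s≤s 1≤s) s+1<p
      transfer : ∀ {a b} → 1 ≤ a → suc a < p → 1 ≤ b → suc b < p → b ℕ.+ suc a ≡ p →
        thetaArg b ≡ 1ℤ * thetaArg a mod P
      transfer 1≤a a+1<p 1≤b b+1<p b+[a+1]≡p = thetaArg-transfer 1ℤ 1ℤ 1≤a a+1<p 1≤b b+1<p
        (mod-trans (defect-reflection 2<p) (mod-reflexive (sym (ℤP.*-identityˡ _))))
        (mod-trans (mod-reflexive (ℤP.*-identityʳ _))
                   (mod-trans coefficient-reflection (mod-reflexive (sym (ℤP.*-identityˡ _)))))
        where open Reflection b+[a+1]≡p

    theta-inversion : ∀ {s t} → 1 ≤ s → s ≤ p ∸ 2 → 1 ≤ t → t ≤ p ∸ 2 →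
      (s ℕ.* t) ℕ.% p ≡ 1 → theta p t ≡ theta p s
    theta-inversion {s} {t} 1≤s s≤p-2 1≤t t≤p-2 st≡1 = legendre-square-transfer p (t ℕ.* t) (s ℕ.* s)
      (transfer 1≤s (below-p 1≤s s≤p-2) 1≤t (below-p 1≤t t≤p-2) st≡1)
      (transfer 1≤t (below-p 1≤t t≤p-2) 1≤s (below-p 1≤s s≤p-2)
                (trans (cong (ℕ._% p) (ℕP.*-comm t s)) st≡1))
      where
      transfer : ∀ {a b} → 1 ≤ a → suc a < p → 1 ≤ b → suc b < p → (a ℕ.* b) ℕ.% p ≡ 1 →
        thetaArg b ≡ + (b ℕ.* b ℕ.* (b ℕ.* b)) * thetaArg a mod P
      transfer {a} {b} 1≤a a+1<p 1≤b b+1<p ab≡1 =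
        thetaArg-transfer ((+ b) ^ p) (+ (b ℕ.* b ℕ.* (b ℕ.* b))) 1≤a a+1<p 1≤b b+1<p
          defect-inversion coefficient-inversion
        where open Inversion {a} {b} ab≡1

open import Data.Nat using (ℕ; zero; suc; _+_; _*_; _∸_; _%_; _≤_; NonZero)
open import Data.Nat.Primality using (Prime; ¬prime[0])
open import Data.Product using (_×_; _,_)
open import Relation.Binary.PropositionalEquality using (_≡_)
open import Relation.Nullary using (contradiction)
open Development using (theta-reflection; theta-inversion)

theorem6p1 : (p : ℕ) .{{_ : NonZero p}} → Prime p →
    (s : ℕ) → 1 ≤ s → s ≤ p ∸ 2 →
    (theta p (p ∸ (1 + s)) ≡ theta p s)
    × ((t : ℕ) → 1 ≤ t → t ≤ p ∸ 2 → (s * t) % p ≡ 1 → theta p t ≡ theta p s)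
theorem6p1 zero    p-prime = contradiction p-prime ¬prime[0]
theorem6p1 (suc n) p-prime s 1≤s s≤p-2 =
  theta-reflection p-prime 1≤s s≤p-2 ,
  λ t 1≤t t≤p-2 → theta-inversion p-prime 1≤s s≤p-2 1≤t t≤p-2
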